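{- Let $a,b$ be indeterminates and let $k\in\mathbb N$ be odd. Then there is a sum-of-squares proof of degree $2k$ (in $a,b$) of $$(a-b)^{2k}\le 2^{2(k-1)}(a^k-b^k)^2,$$ i.e. $2^{2(k-1)}(a^k-b^k)^2-(a-b)^{2k}$ is a sum of squares of polynomials of degree at most $k$. -}

module Defs where

open import Data.Nat using (ℕ; zero; suc; _≤_) renaming (_+_ to _+ℕ_; _*_ to _*ℕ_)
open import Data.Rational using (ℚ; 0ℚ; 1ℚ; _+_; _*_)
open import Data.Product using (_×_; _,_; ∃-syntax)
open import Data.List using (List; []; _∷_)
open import Data.List.Relation.Unary.All using (All)
open import Relation.Binary.PropositionalEquality using (_≡_)

Odd : ℕ → Set
Odd k = ∃[ m ] k ≡ 2 *ℕ m +ℕ 1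

infixr 8 _^_
_^_ : ℚ → ℕ → ℚ
x ^ zero  = 1ℚ
x ^ suc n = x * (x ^ n)

-- A polynomial in two indeterminates a, b with rational coefficients,
-- given as a finite list of monomials (i , j , c) meaning c · a^i · b^j.
Monomial : Set
Monomial = ℕ × ℕ × ℚ

Poly2 : Set
Poly2 = List Monomial

eval : Poly2 → ℚ → ℚ → ℚ
eval []              a b = 0ℚ
eval ((i , j , c) ∷ p) a b = c * (a ^ i) * (b ^ j) + eval p a b

DegreeAtMost : ℕ → Poly2 → Set
DegreeAtMost d p = All (λ { (i , j , c) → i +ℕ j ≤ d }) p

sumSq : List Poly2 → ℚ → ℚ → ℚ
sumSq []       a b = 0ℚ
sumSq (q ∷ qs) a b = (eval q a b) ^ 2 + sumSq qs a b

-- Put u = (a + b)/2, v = (a - b)/2 and k = 2m + 1. Collecting the binomial expansion by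
-- parity in v gives (u ± v)^k = u Q ± v P, where P and Q are polynomials in u², v² with
-- nonnegative integer coefficients, and P contains v^2m with coefficient 1. Hence
-- a^k - b^k = 2vP, a - b = 2v, and
--   4^(k-1) (a^k - b^k)² - (a - b)^2k = 4^k v² (P - v^2m) (P + v^2m).
-- Sums of squares are closed under sums and products, and u², v² are squares of linear
-- forms, so P ± v^2m are sums of squares of polynomials of degree m, and the right-hand
-- side is a sum of squares of polynomials of degree 1 + 2m = k.

module Submission where

open import Defs
open import Data.Nat using (ℕ; zero; suc; _∸_; _≤_) renaming (_+_ to _+ℕ_; _*_ to _*ℕ_)
import Data.Nat.Properties as ℕ
open import Algebra.Properties.CommutativeSemigroup ℕ.+-commutativeSemigroup using ()
  renaming (interchange to +-interchange)
open import Data.Rational using (ℚ; 0ℚ; 1ℚ; _+_; _*_; _-_; -_; ½; -½)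
open import Data.Rational.Properties
  using (+-*-commutativeRing; _≟_; +-identityˡ; +-identityʳ; +-assoc;
         *-identityˡ; *-identityʳ; *-assoc; *-zeroˡ; *-zeroʳ; *-distribˡ-+; *-distribʳ-+)
open import Data.Product using (Σ; _×_; _,_)
open import Data.List using (List; []; _∷_; _++_; map; cartesianProductWith)
open import Data.List.Relation.Unary.All as All using (All; []; _∷_)
import Data.List.Relation.Unary.All.Properties as All
open import Level using (0ℓ)
open import Relation.Binary.PropositionalEquality
open import Relation.Nullary.Decidable using (dec⇒maybe)
open import Tactic.RingSolver using (solve-∀)
open import Tactic.RingSolver.Core.AlmostCommutativeRing using (AlmostCommutativeRing; fromCommutativeRing)

ℚ-ring : AlmostCommutativeRing 0ℓ 0ℓ
ℚ-ring = fromCommutativeRing +-*-commutativeRing (λ x → dec⇒maybe (0ℚ ≟ x))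

2ℚ : ℚ
2ℚ = 1ℚ + 1ℚ

-- The solver does not recognise the _^_ of Defs, so squares are kept as products.
x^2≡x*x : ∀ x → x ^ 2 ≡ x * x
x^2≡x*x x = cong (x *_) (*-identityʳ x)

^-distribˡ-+-* : ∀ x m n → x ^ (m +ℕ n) ≡ x ^ m * x ^ n
^-distribˡ-+-* x zero    n = sym (*-identityˡ (x ^ n))
^-distribˡ-+-* x (suc m) n =
  trans (cong (x *_) (^-distribˡ-+-* x m n)) (sym (*-assoc x (x ^ m) (x ^ n)))

*-interchange : ∀ x y z w → x * y * (z * w) ≡ x * z * (y * w)
*-interchange = solve-∀ ℚ-ring

^-distribʳ-* : ∀ x y n → (x * y) ^ n ≡ x ^ n * y ^ n
^-distribʳ-* x y zero    = refl
^-distribʳ-* x y (suc n) =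
  trans (cong ((x * y) *_) (^-distribʳ-* x y n)) (*-interchange x y (x ^ n) (y ^ n))

x^2n≡x^n*x^n : ∀ x n → x ^ (2 *ℕ n) ≡ x ^ n * x ^ n
x^2n≡x^n*x^n x n = trans (cong (λ e → x ^ (n +ℕ e)) (ℕ.+-identityʳ n)) (^-distribˡ-+-* x n n)

x^2n≡[x*x]^n : ∀ x n → x ^ (2 *ℕ n) ≡ (x * x) ^ n
x^2n≡[x*x]^n x n = trans (x^2n≡x^n*x^n x n) (sym (^-distribʳ-* x x n))

term : Monomial → ℚ → ℚ → ℚ
term (i , j , c) a b = c * a ^ i * b ^ j

infixl 7 _*ₘ_ _*ₚ_

_*ₘ_ : Monomial → Monomial → Monomial
(i , j , c) *ₘ (i′ , j′ , c′) = (i +ℕ i′ , j +ℕ j′ , c * c′)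

_*ₚ_ : Poly2 → Poly2 → Poly2
_*ₚ_ = cartesianProductWith _*ₘ_

term-*ₘ : ∀ m m′ a b → term (m *ₘ m′) a b ≡ term m a b * term m′ a b
term-*ₘ (i , j , c) (i′ , j′ , c′) a b =
  trans (cong₂ (λ x y → c * c′ * x * y) (^-distribˡ-+-* a i i′) (^-distribˡ-+-* b j j′))
        (shuffle c c′ (a ^ i) (a ^ i′) (b ^ j) (b ^ j′))
  where
  shuffle : ∀ c c′ x x′ y y′ → c * c′ * (x * x′) * (y * y′) ≡ c * x * y * (c′ * x′ * y′)
  shuffle = solve-∀ ℚ-ring

eval-++ : ∀ p q a b → eval (p ++ q) a b ≡ eval p a b + eval q a b
eval-++ []      q a b = sym (+-identityˡ (eval q a b))
eval-++ (m ∷ p) q a b = trans (cong (term m a b +_) (eval-++ p q a b)) (sym (+-assoc (term m a b) _ _))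

eval-map-*ₘ : ∀ m q a b → eval (map (m *ₘ_) q) a b ≡ term m a b * eval q a b
eval-map-*ₘ m []        a b = sym (*-zeroʳ (term m a b))
eval-map-*ₘ m (m′ ∷ q) a b = begin
  term (m *ₘ m′) a b + eval (map (m *ₘ_) q) a b  ≡⟨ cong₂ _+_ (term-*ₘ m m′ a b) (eval-map-*ₘ m q a b) ⟩
  term m a b * term m′ a b + term m a b * eval q a b ≡⟨ sym (*-distribˡ-+ (term m a b) _ _) ⟩
  term m a b * (term m′ a b + eval q a b)         ∎
  where open ≡-Reasoning

eval-*ₚ : ∀ p q a b → eval (p *ₚ q) a b ≡ eval p a b * eval q a b
eval-*ₚ []      q a b = sym (*-zeroˡ (eval q a b))
eval-*ₚ (m ∷ p) q a b = begin
  eval (map (m *ₘ_) q ++ p *ₚ q) a b                   ≡⟨ eval-++ (map (m *ₘ_) q) (p *ₚ q) a b ⟩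
  eval (map (m *ₘ_) q) a b + eval (p *ₚ q) a b         ≡⟨ cong₂ _+_ (eval-map-*ₘ m q a b) (eval-*ₚ p q a b) ⟩
  term m a b * eval q a b + eval p a b * eval q a b   ≡⟨ sym (*-distribʳ-+ (eval q a b) (term m a b) _) ⟩
  (term m a b + eval p a b) * eval q a b              ∎
  where open ≡-Reasoning

totalDegree : Monomial → ℕ
totalDegree (i , j , _) = i +ℕ j

totalDegree-*ₘ : ∀ m m′ → totalDegree (m *ₘ m′) ≡ totalDegree m +ℕ totalDegree m′
totalDegree-*ₘ (i , j , _) (i′ , j′ , _) = sym (+-interchange i j i′ j′)

DegreeAtMost-*ₚ : ∀ {d e} p q → DegreeAtMost d p → DegreeAtMost e q → DegreeAtMost (d +ℕ e) (p *ₚ q)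
DegreeAtMost-*ₚ {d} {e} p q dp dq =
  All.cartesianProductWith⁺ (setoid Monomial) (setoid Monomial) _*ₘ_ p q
  (λ {m} {m′} m∈p m′∈q → subst (_≤ d +ℕ e) (sym (totalDegree-*ₘ m m′))
                           (ℕ.+-mono-≤ (All.lookup dp m∈p) (All.lookup dq m′∈q)))

constant : ℚ → Poly2
constant c = (0 , 0 , c) ∷ []

eval-constant : ∀ c a b → eval (constant c) a b ≡ c
eval-constant c a b =
  trans (+-identityʳ (c * 1ℚ * 1ℚ)) (trans (*-identityʳ (c * 1ℚ)) (*-identityʳ c))

linear : ℚ → ℚ → Poly2
linear α β = (1 , 0 , α) ∷ (0 , 1 , β) ∷ []

eval-linear : ∀ α β a b → eval (linear α β) a b ≡ α * a + β * b
eval-linear α β a b = drop-units α β a b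
  where
  drop-units : ∀ α β a b → α * (a * 1ℚ) * 1ℚ + (β * 1ℚ * (b * 1ℚ) + 0ℚ) ≡ α * a + β * b
  drop-units = solve-∀ ℚ-ring

DegreeAtMost-linear : ∀ α β → DegreeAtMost 1 (linear α β)
DegreeAtMost-linear α β = ℕ.≤-refl ∷ ℕ.≤-refl ∷ []

sumSq-++ : ∀ ps qs a b → sumSq (ps ++ qs) a b ≡ sumSq ps a b + sumSq qs a b
sumSq-++ []       qs a b = sym (+-identityˡ (sumSq qs a b))
sumSq-++ (p ∷ ps) qs a b =
  trans (cong (eval p a b ^ 2 +_) (sumSq-++ ps qs a b)) (sym (+-assoc (eval p a b ^ 2) _ _))

sumSq-map-*ₚ : ∀ p qs a b → sumSq (map (p *ₚ_) qs) a b ≡ eval p a b ^ 2 * sumSq qs a b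
sumSq-map-*ₚ p []       a b = sym (*-zeroʳ (eval p a b ^ 2))
sumSq-map-*ₚ p (q ∷ qs) a b = begin
  eval (p *ₚ q) a b ^ 2 + sumSq (map (p *ₚ_) qs) a b
    ≡⟨ cong₂ (λ x y → x ^ 2 + y) (eval-*ₚ p q a b) (sumSq-map-*ₚ p qs a b) ⟩
  (eval p a b * eval q a b) ^ 2 + eval p a b ^ 2 * sumSq qs a b
    ≡⟨ cong (_+ eval p a b ^ 2 * sumSq qs a b) (^-distribʳ-* (eval p a b) (eval q a b) 2) ⟩
  eval p a b ^ 2 * eval q a b ^ 2 + eval p a b ^ 2 * sumSq qs a b
    ≡⟨ sym (*-distribˡ-+ (eval p a b ^ 2) _ _) ⟩
  eval p a b ^ 2 * (eval q a b ^ 2 + sumSq qs a b)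
    ∎
  where open ≡-Reasoning

sumSq-cartesianProductWith : ∀ ps qs a b →
  sumSq (cartesianProductWith _*ₚ_ ps qs) a b ≡ sumSq ps a b * sumSq qs a b
sumSq-cartesianProductWith []       qs a b = sym (*-zeroˡ (sumSq qs a b))
sumSq-cartesianProductWith (p ∷ ps) qs a b = begin
  sumSq (map (p *ₚ_) qs ++ cartesianProductWith _*ₚ_ ps qs) a b
    ≡⟨ sumSq-++ (map (p *ₚ_) qs) _ a b ⟩
  sumSq (map (p *ₚ_) qs) a b + sumSq (cartesianProductWith _*ₚ_ ps qs) a b
    ≡⟨ cong₂ _+_ (sumSq-map-*ₚ p qs a b) (sumSq-cartesianProductWith ps qs a b) ⟩
  eval p a b ^ 2 * sumSq qs a b + sumSq ps a b * sumSq qs a b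
    ≡⟨ sym (*-distribʳ-+ (sumSq qs a b) (eval p a b ^ 2) _) ⟩
  (eval p a b ^ 2 + sumSq ps a b) * sumSq qs a b
    ∎
  where open ≡-Reasoning

SumOfSquares : ℕ → (ℚ → ℚ → ℚ) → Set
SumOfSquares d f = Σ (List Poly2) λ qs → All (DegreeAtMost d) qs × (∀ a b → f a b ≡ sumSq qs a b)

sos-resp : ∀ {d f g} → (∀ a b → f a b ≡ g a b) → SumOfSquares d f → SumOfSquares d g
sos-resp f≡g (qs , dqs , f≡qs) = qs , dqs , λ a b → trans (sym (f≡g a b)) (f≡qs a b)

sos-0 : ∀ {d} → SumOfSquares d (λ _ _ → 0ℚ)
sos-0 = [] , [] , λ _ _ → refl

sos-square : ∀ {d} p → DegreeAtMost d p → SumOfSquares d (λ a b → eval p a b * eval p a b)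
sos-square p dp = p ∷ [] , dp ∷ [] ,
  λ a b → trans (sym (x^2≡x*x (eval p a b))) (sym (+-identityʳ (eval p a b ^ 2)))

sos-+ : ∀ {d f g} → SumOfSquares d f → SumOfSquares d g → SumOfSquares d (λ a b → f a b + g a b)
sos-+ (ps , dps , f≡ps) (qs , dqs , g≡qs) = ps ++ qs , All.++⁺ dps dqs ,
  λ a b → trans (cong₂ _+_ (f≡ps a b) (g≡qs a b)) (sym (sumSq-++ ps qs a b))

sos-* : ∀ {d e f g} → SumOfSquares d f → SumOfSquares e g →
        SumOfSquares (d +ℕ e) (λ a b → f a b * g a b)
sos-* (ps , dps , f≡ps) (qs , dqs , g≡qs) =
  cartesianProductWith _*ₚ_ ps qs ,
  All.cartesianProductWith⁺ (setoid Poly2) (setoid Poly2) _*ₚ_ ps qs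
    (λ p∈ps q∈qs → DegreeAtMost-*ₚ _ _ (All.lookup dps p∈ps) (All.lookup dqs q∈qs)) ,
  λ a b → trans (cong₂ _*_ (f≡ps a b) (g≡qs a b)) (sym (sumSq-cartesianProductWith ps qs a b))

sos-constant : ∀ c → SumOfSquares 0 (λ _ _ → c * c)
sos-constant c = sos-resp (λ a b → cong₂ _*_ (eval-constant c a b) (eval-constant c a b))
                          (sos-square (constant c) (ℕ.≤-refl ∷ []))

sos-1 : SumOfSquares 0 (λ _ _ → 1ℚ)
sos-1 = sos-resp (λ _ _ → *-identityˡ 1ℚ) (sos-constant 1ℚ)

sos-2 : SumOfSquares 0 (λ _ _ → 2ℚ)
sos-2 = sos-+ sos-1 sos-1

sos-^ : ∀ {d f} n → SumOfSquares d f → SumOfSquares (n *ℕ d) (λ a b → f a b ^ n)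
sos-^ zero    sos-f = sos-1
sos-^ (suc n) sos-f = sos-* sos-f (sos-^ n sos-f)

mutual
  oddPart : ℚ → ℚ → ℕ → ℚ
  oddPart s t zero    = 1ℚ
  oddPart s t (suc m) = (s + t) * oddPart s t m + 2ℚ * s * evenPart s t m

  evenPart : ℚ → ℚ → ℕ → ℚ
  evenPart s t zero    = 1ℚ
  evenPart s t (suc m) = (s + t) * evenPart s t m + 2ℚ * t * oddPart s t m

odd-binomial : ∀ x y m →
  (x + y) ^ suc (2 *ℕ m) ≡ y * oddPart (x * x) (y * y) m + x * evenPart (x * x) (y * y) m
odd-binomial x y zero    = split x y
  where
  split : ∀ x y → (x + y) * 1ℚ ≡ y * 1ℚ + x * 1ℚ
  split = solve-∀ ℚ-ring
odd-binomial x y (suc m) = begin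
  (x + y) ^ suc (2 *ℕ suc m)                    ≡⟨ cong (λ n → (x + y) ^ suc n) (ℕ.*-suc 2 m) ⟩
  (x + y) * ((x + y) * (x + y) ^ suc (2 *ℕ m))  ≡⟨ cong (λ z → (x + y) * ((x + y) * z)) (odd-binomial x y m) ⟩
  (x + y) * ((x + y) * (y * P + x * Q))         ≡⟨ multiply-by-square x y P Q ⟩
  y * oddPart (x * x) (y * y) (suc m) + x * evenPart (x * x) (y * y) (suc m) ∎
  where
  open ≡-Reasoning
  P Q : ℚ
  P = oddPart (x * x) (y * y) m
  Q = evenPart (x * x) (y * y) m
  multiply-by-square : ∀ x y p q → (x + y) * ((x + y) * (y * p + x * q)) ≡
    y * ((x * x + y * y) * p + 2ℚ * (x * x) * q) + x * ((x * x + y * y) * q + 2ℚ * (y * y) * p)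
  multiply-by-square = solve-∀ ℚ-ring

odd-power-difference : ∀ x y m →
  (x + y) ^ suc (2 *ℕ m) - (x - y) ^ suc (2 *ℕ m) ≡ 2ℚ * y * oddPart (x * x) (y * y) m
odd-power-difference x y m = begin
  (x + y) ^ suc (2 *ℕ m) - (x + - y) ^ suc (2 *ℕ m)
    ≡⟨ cong₂ _-_ (odd-binomial x y m) (odd-binomial x (- y) m) ⟩
  (y * P + x * Q) - (- y * oddPart (x * x) (- y * - y) m + x * evenPart (x * x) (- y * - y) m)
    ≡⟨ cong (λ t → (y * P + x * Q) - (- y * oddPart (x * x) t m + x * evenPart (x * x) t m))
            (neg-square y) ⟩
  (y * P + x * Q) - (- y * P + x * Q)
    ≡⟨ cancel x y P Q ⟩
  2ℚ * y * P
    ∎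
  where
  open ≡-Reasoning
  P Q : ℚ
  P = oddPart (x * x) (y * y) m
  Q = evenPart (x * x) (y * y) m
  neg-square : ∀ y → - y * - y ≡ y * y
  neg-square = solve-∀ ℚ-ring
  cancel : ∀ x y p q → (y * p + x * q) - (- y * p + x * q) ≡ 2ℚ * y * p
  cancel = solve-∀ ℚ-ring

module _ {s t : ℚ → ℚ → ℚ} (sos-s : SumOfSquares 1 s) (sos-t : SumOfSquares 1 t) where

  mutual
    sos-oddPart : ∀ m → SumOfSquares m (λ a b → oddPart (s a b) (t a b) m)
    sos-oddPart zero    = sos-1
    sos-oddPart (suc m) =
      sos-+ (sos-* (sos-+ sos-s sos-t) (sos-oddPart m)) (sos-* (sos-* sos-2 sos-s) (sos-evenPart m))

    sos-evenPart : ∀ m → SumOfSquares m (λ a b → evenPart (s a b) (t a b) m)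
    sos-evenPart zero    = sos-1
    sos-evenPart (suc m) =
      sos-+ (sos-* (sos-+ sos-s sos-t) (sos-evenPart m)) (sos-* (sos-* sos-2 sos-t) (sos-oddPart m))

  sos-t^ : ∀ m → SumOfSquares m (λ a b → t a b ^ m)
  sos-t^ m = subst (λ d → SumOfSquares d (λ a b → t a b ^ m)) (ℕ.*-identityʳ m) (sos-^ m sos-t)

  sos-oddPart-minus-t^ : ∀ m → SumOfSquares m (λ a b → oddPart (s a b) (t a b) m - t a b ^ m)
  sos-oddPart-minus-t^ zero    = sos-0
  sos-oddPart-minus-t^ (suc m) = sos-resp
    (λ a b → regroup (s a b) (t a b) (oddPart (s a b) (t a b) m) (evenPart (s a b) (t a b) m) (t a b ^ m))
    (sos-+ (sos-+ (sos-* (sos-+ sos-s sos-t) (sos-oddPart-minus-t^ m)) (sos-* sos-s (sos-t^ m)))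
           (sos-* (sos-* sos-2 sos-s) (sos-evenPart m)))
    where
    regroup : ∀ s t p q x → (s + t) * (p - x) + s * x + 2ℚ * s * q ≡ (s + t) * p + 2ℚ * s * q - t * x
    regroup = solve-∀ ℚ-ring

Gap : ℕ → ℚ → ℚ → ℚ
Gap k a b = 2ℚ ^ (2 *ℕ (k ∸ 1)) * (a ^ k - b ^ k) ^ 2 - (a - b) ^ (2 *ℕ k)

Gap-factorisation : ∀ m u v →
  let P = oddPart (u * u) (v * v) m
      X = (v * v) ^ m
      c = 2ℚ * (2ℚ * 2ℚ) ^ m
  in Gap (suc (2 *ℕ m)) (u + v) (u - v) ≡ c * c * (v * v * ((P - X) * (P + X)))
Gap-factorisation m u v = begin
  2ℚ ^ (2 *ℕ (2 *ℕ m)) * ((u + v) ^ k - (u - v) ^ k) ^ 2 - ((u + v) - (u - v)) ^ (2 *ℕ k)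
    ≡⟨ cong₂ (λ d e → 2ℚ ^ (2 *ℕ (2 *ℕ m)) * d ^ 2 - e ^ (2 *ℕ k))
             (odd-power-difference u v m) (difference u v) ⟩
  2ℚ ^ (2 *ℕ (2 *ℕ m)) * (2ℚ * v * P) ^ 2 - (2ℚ * v) ^ (2 *ℕ k)
    ≡⟨ cong₂ (λ c e → c * e - (2ℚ * v) ^ (2 *ℕ k)) power-of-2 (x^2≡x*x (2ℚ * v * P)) ⟩
  F * F * (2ℚ * v * P * (2ℚ * v * P)) - (2ℚ * v) ^ (2 *ℕ k)
    ≡⟨ cong (λ e → F * F * (2ℚ * v * P * (2ℚ * v * P)) - e) power-of-2v ⟩
  F * F * (2ℚ * v * P * (2ℚ * v * P)) - w * (F * X * (F * X))
    ≡⟨ factorise F v P X ⟩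
  2ℚ * F * (2ℚ * F) * (v * v * ((P - X) * (P + X)))
    ∎
  where
  open ≡-Reasoning
  k : ℕ
  k = suc (2 *ℕ m)

  P X F w : ℚ
  P = oddPart (u * u) (v * v) m
  X = (v * v) ^ m
  F = (2ℚ * 2ℚ) ^ m
  w = 2ℚ * v * (2ℚ * v)

  power-of-2 : 2ℚ ^ (2 *ℕ (2 *ℕ m)) ≡ F * F
  power-of-2 = trans (x^2n≡[x*x]^n 2ℚ (2 *ℕ m)) (x^2n≡x^n*x^n (2ℚ * 2ℚ) m)

  power-of-2v : (2ℚ * v) ^ (2 *ℕ k) ≡ w * (F * X * (F * X))
  power-of-2v = begin
    (2ℚ * v) ^ (2 *ℕ k)  ≡⟨ x^2n≡[x*x]^n (2ℚ * v) k ⟩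
    w * w ^ (2 *ℕ m)     ≡⟨ cong (w *_) (x^2n≡x^n*x^n w m) ⟩
    w * (w ^ m * w ^ m)  ≡⟨ cong (λ z → w * (z * z)) w^m ⟩
    w * (F * X * (F * X)) ∎
    where
    w^m : w ^ m ≡ F * X
    w^m = trans (cong (_^ m) (*-interchange 2ℚ v 2ℚ v)) (^-distribʳ-* (2ℚ * 2ℚ) (v * v) m)

  difference : ∀ u v → (u + v) - (u - v) ≡ 2ℚ * v
  difference = solve-∀ ℚ-ring

  factorise : ∀ f v p x →
    f * f * (2ℚ * v * p * (2ℚ * v * p)) - 2ℚ * v * (2ℚ * v) * (f * x * (f * x))
      ≡ 2ℚ * f * (2ℚ * f) * (v * v * ((p - x) * (p + x)))
  factorise = solve-∀ ℚ-ring

sos-Gap : ∀ m → SumOfSquares (suc (2 *ℕ m)) (Gap (suc (2 *ℕ m)))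
sos-Gap m =
  subst (λ d → SumOfSquares d (Gap k)) (cong suc (cong (m +ℕ_) (sym (ℕ.+-identityʳ m))))
    (sos-resp (λ a b → trans (sym (Gap-factorisation m (eval u a b) (eval v a b)))
                             (cong₂ (Gap k) (sym (a≡u+v a b)) (sym (b≡u-v a b))))
      (sos-* (sos-constant c) (sos-* sos-v²
        (sos-* (sos-oddPart-minus-t^ sos-u² sos-v² m)
               (sos-+ (sos-oddPart sos-u² sos-v² m) (sos-t^ sos-u² sos-v² m))))))
  where
  k : ℕ
  k = suc (2 *ℕ m)

  c : ℚ
  c = 2ℚ * (2ℚ * 2ℚ) ^ m

  u v : Poly2
  u = linear ½ ½
  v = linear ½ -½

  sos-u² : SumOfSquares 1 (λ a b → eval u a b * eval u a b)
  sos-u² = sos-square u (DegreeAtMost-linear ½ ½)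

  sos-v² : SumOfSquares 1 (λ a b → eval v a b * eval v a b)
  sos-v² = sos-square v (DegreeAtMost-linear ½ -½)

  a≡u+v : ∀ a b → a ≡ eval u a b + eval v a b
  a≡u+v a b = trans (halves a b) (sym (cong₂ _+_ (eval-linear ½ ½ a b) (eval-linear ½ -½ a b)))
    where
    halves : ∀ a b → a ≡ (½ * a + ½ * b) + (½ * a + -½ * b)
    halves = solve-∀ ℚ-ring

  b≡u-v : ∀ a b → b ≡ eval u a b - eval v a b
  b≡u-v a b = trans (halves a b) (sym (cong₂ _-_ (eval-linear ½ ½ a b) (eval-linear ½ -½ a b)))
    where
    halves : ∀ a b → b ≡ (½ * a + ½ * b) - (½ * a + -½ * b)
    halves = solve-∀ ℚ-ring

lemma4p51 : (k : ℕ) → Odd k →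
    Σ (List Poly2) (λ qs →
      All (DegreeAtMost k) qs ×
      ((a b : ℚ) →
        ((1ℚ + 1ℚ) ^ (2 *ℕ (k ∸ 1))) * ((a ^ k) - (b ^ k)) ^ 2 - (a - b) ^ (2 *ℕ k)
          ≡ sumSq qs a b))
lemma4p51 .(2 *ℕ m +ℕ 1) (m , refl) =
  subst (λ k → SumOfSquares k (Gap k)) (ℕ.+-comm 1 (2 *ℕ m)) (sos-Gap m)
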